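{- Let $A$ be a totally ordered alphabet and let $w$ be a Lyndon word over $A$ of length at least $2$, with left standard factorization $w=uv$. Suppose $v$ is not a single letter, and let $v=v_1v_2$ be the left standard factorization of $v$. Then $v_1$ is a prefix of $u$.
   Context: The order $<$ is the lexicographical order on $A^*$ induced by the order of $A$. A nonempty word $w$ is a Lyndon word if for every factorization $w=uv$ with $u,v$ nonempty one has $w<v$. The left standard factorization of a Lyndon word $w$ of length at least $2$ is $w=uv$ where $u$ is the longest nonempty proper prefix of $w$ that is a Lyndon word; it is known that then $u$ and $v$ are both Lyndon words and $u<v$ (so the left standard factorization of $v$ makes sense when $|v|\ge2$). -}

module Defs where

open import Level using (Level)
open import Data.List using (List; []; _∷_; _++_; length)
open import Data.Nat using (_<_)
open import Data.Product using (Σ; _×_; ∃; _,_)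
open import Data.Empty using (⊥)
open import Relation.Nullary using (¬_)
open import Relation.Binary.PropositionalEquality using (_≡_)
open import Relation.Binary.Structures using (IsStrictTotalOrder)

module Words {a ℓ : Level} (A : Set a) (_≺_ : A → A → Set ℓ)
             (isSTO : IsStrictTotalOrder _≡_ _≺_) where

  Word : Set a
  Word = List A

  NonEmpty : Word → Set a
  NonEmpty w = ¬ (w ≡ [])

  data _<ˡ_ : Word → Word → Set (Level._⊔_ a ℓ) where
    []<∷   : ∀ {x xs} → [] <ˡ (x ∷ xs)
    here   : ∀ {x y xs ys} → x ≺ y → (x ∷ xs) <ˡ (y ∷ ys)
    there  : ∀ {x xs ys} → xs <ˡ ys → (x ∷ xs) <ˡ (x ∷ ys)

  IsLyndon : Word → Set (Level._⊔_ a ℓ)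
  IsLyndon w = NonEmpty w ×
    (∀ (u v : Word) → NonEmpty u → NonEmpty v → w ≡ u ++ v → w <ˡ v)

  IsPrefix : Word → Word → Set a
  IsPrefix u w = Σ Word (λ t → w ≡ u ++ t)

  IsLeftStdFact : Word → Word → Word → Set (Level._⊔_ a ℓ)
  IsLeftStdFact w u v =
    w ≡ u ++ v × NonEmpty u × NonEmpty v × IsLyndon u ×
    (∀ (u' v' : Word) → w ≡ u' ++ v' → NonEmpty v' → IsLyndon u' →
       length u' Data.Nat.≤ length u)

-- Compare u with v₁.  If u < v₁, then u v₁ is a Lyndon word (a product of Lyndon
-- words in increasing order is Lyndon) and a proper prefix of w = u v₁ v₂ longer
-- than u, contradicting the maximality of u.  If v₁ is smaller than u at their
-- first difference, then v = v₁ v₂ < u v = w, contradicting w < v.  The only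
-- remaining possibility is that v₁ is a prefix of u.
module Submission where

open import Defs
open import Level using (Level; _⊔_)
open import Data.List using (List; []; _∷_; _++_; length)
open import Data.List.Properties using (++-assoc; ++-identityʳ; length-++-≤ˡ; length-++-≤ʳ; ∷-injective)
open import Data.Nat using (_≤_; _<_; z≤n; s≤s)
open import Data.Nat.Properties using (<⇒≱; ≤-<-trans; <-irrefl)
open import Data.Product using (Σ; _×_; _,_; proj₁)
open import Data.Sum using (_⊎_; inj₁; inj₂)
open import Data.Empty using (⊥-elim)
open import Relation.Nullary using (¬_)
open import Relation.Binary.PropositionalEquality using (_≡_; refl; sym; trans; cong; subst; subst₂)
open import Relation.Binary.Structures using (IsStrictTotalOrder)
open import Relation.Binary.Definitions using (tri<; tri≈; tri>)

module LyndonWords {a ℓ : Level} (A : Set a) (_≺_ : A → A → Set ℓ)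
                   (isSTO : IsStrictTotalOrder _≡_ _≺_) where

  open Words A _≺_ isSTO
  open IsStrictTotalOrder isSTO using (compare)
    renaming (trans to ≺-trans; irrefl to ≺-irrefl)

  length-++-<ˡ : ∀ u {t : Word} → NonEmpty t → length u < length (u ++ t)
  length-++-<ˡ []      {[]}    t≢[] = ⊥-elim (t≢[] refl)
  length-++-<ˡ []      {_ ∷ _} t≢[] = s≤s z≤n
  length-++-<ˡ (_ ∷ u)         t≢[] = s≤s (length-++-<ˡ u t≢[])

  length-++-<ʳ : ∀ {x : Word} u → NonEmpty x → length u < length (x ++ u)
  length-++-<ʳ {[]}    u x≢[] = ⊥-elim (x≢[] refl)
  length-++-<ʳ {_ ∷ x} u x≢[] = s≤s (length-++-≤ʳ u {x})

  ++-nonEmptyˡ : ∀ {u} v → NonEmpty u → NonEmpty (u ++ v)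
  ++-nonEmptyˡ {[]}    v u≢[] = ⊥-elim (u≢[] refl)
  ++-nonEmptyˡ {_ ∷ _} v u≢[] = λ ()

  ++-nonEmptyʳ : ∀ u {v} → NonEmpty v → NonEmpty (u ++ v)
  ++-nonEmptyʳ []      v≢[] = v≢[]
  ++-nonEmptyʳ (_ ∷ _) v≢[] = λ ()

  ++-equidivisible : ∀ x y u v → u ++ v ≡ x ++ y →
    (Σ Word λ m → x ≡ u ++ m × v ≡ m ++ y) ⊎
    (Σ Word λ m → NonEmpty m × u ≡ x ++ m × y ≡ m ++ v)
  ++-equidivisible []      y []      v eq = inj₁ ([] , refl , eq)
  ++-equidivisible (c ∷ x) y []      v eq = inj₁ (c ∷ x , refl , eq)
  ++-equidivisible []      y (c ∷ u) v eq = inj₂ (c ∷ u , (λ ()) , refl , sym eq)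
  ++-equidivisible (c ∷ x) y (d ∷ u) v eq with ∷-injective eq
  ... | refl , eq′ with ++-equidivisible x y u v eq′
  ...   | inj₁ (m , x≡um , v≡my)       = inj₁ (m , cong (c ∷_) x≡um , v≡my)
  ...   | inj₂ (m , m≢[] , u≡xm , y≡mv) = inj₂ (m , m≢[] , cong (c ∷_) u≡xm , y≡mv)

  <ˡ-irrefl : ∀ {p} → ¬ (p <ˡ p)
  <ˡ-irrefl (here x≺x)  = ≺-irrefl refl x≺x
  <ˡ-irrefl (there p<p) = <ˡ-irrefl p<p

  <ˡ-trans : ∀ {p q r} → p <ˡ q → q <ˡ r → p <ˡ r
  <ˡ-trans []<∷      (here _)  = []<∷
  <ˡ-trans []<∷      (there _) = []<∷
  <ˡ-trans (here x≺y) (here y≺z) = here (≺-trans x≺y y≺z)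
  <ˡ-trans (here x≺y) (there _)  = here x≺y
  <ˡ-trans (there _)  (here y≺z) = here y≺z
  <ˡ-trans (there p<q) (there q<r) = there (<ˡ-trans p<q q<r)

  <ˡ-asym : ∀ {p q} → p <ˡ q → ¬ (q <ˡ p)
  <ˡ-asym p<q q<p = <ˡ-irrefl (<ˡ-trans p<q q<p)

  ++-monoʳ-<ˡ : ∀ c {p q} → p <ˡ q → (c ++ p) <ˡ (c ++ q)
  ++-monoʳ-<ˡ []      p<q = p<q
  ++-monoʳ-<ˡ (_ ∷ c) p<q = there (++-monoʳ-<ˡ c p<q)

  ++-<ˡ : ∀ u {t} → NonEmpty t → u <ˡ (u ++ t)
  ++-<ˡ []      {[]}    t≢[] = ⊥-elim (t≢[] refl)
  ++-<ˡ []      {_ ∷ _} t≢[] = []<∷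
  ++-<ˡ (_ ∷ u)         t≢[] = there (++-<ˡ u t≢[])

  -- Strict order at a first difference: unlike _<ˡ_, it survives extending both
  -- sides arbitrarily.
  data _<ᵈ_ : Word → Word → Set (a ⊔ ℓ) where
    here  : ∀ {x y xs ys} → x ≺ y → (x ∷ xs) <ᵈ (y ∷ ys)
    there : ∀ {x xs ys} → xs <ᵈ ys → (x ∷ xs) <ᵈ (x ∷ ys)

  <ᵈ⇒<ˡ : ∀ {p q} → p <ᵈ q → p <ˡ q
  <ᵈ⇒<ˡ (here x≺y)  = here x≺y
  <ᵈ⇒<ˡ (there p<q) = there (<ᵈ⇒<ˡ p<q)

  <ᵈ-++ : ∀ {p q} → p <ᵈ q → ∀ x y → (p ++ x) <ᵈ (q ++ y)
  <ᵈ-++ (here x≺y)  _ _ = here x≺y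
  <ᵈ-++ (there p<q) x y = there (<ᵈ-++ p<q x y)

  <ᵈ-++⇒<ˡ : ∀ {p q} → p <ᵈ q → ∀ x y → (p ++ x) <ˡ (q ++ y)
  <ᵈ-++⇒<ˡ p<q x y = <ᵈ⇒<ˡ (<ᵈ-++ p<q x y)

  <ˡ⇒properPrefix⊎<ᵈ : ∀ {p q} → p <ˡ q →
    (Σ Word λ t → NonEmpty t × q ≡ p ++ t) ⊎ p <ᵈ q
  <ˡ⇒properPrefix⊎<ᵈ ([]<∷ {x} {xs}) = inj₁ (x ∷ xs , (λ ()) , refl)
  <ˡ⇒properPrefix⊎<ᵈ (here x≺y)       = inj₂ (here x≺y)
  <ˡ⇒properPrefix⊎<ᵈ (there {x} p<q) with <ˡ⇒properPrefix⊎<ᵈ p<q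
  ... | inj₁ (t , t≢[] , q≡pt) = inj₁ (t , t≢[] , cong (x ∷_) q≡pt)
  ... | inj₂ p<ᵈq              = inj₂ (there p<ᵈq)

  <ˡ⊎prefix⊎>ᵈ : ∀ p q → p <ˡ q ⊎ IsPrefix q p ⊎ q <ᵈ p
  <ˡ⊎prefix⊎>ᵈ []      []      = inj₂ (inj₁ ([] , refl))
  <ˡ⊎prefix⊎>ᵈ []      (_ ∷ _) = inj₁ []<∷
  <ˡ⊎prefix⊎>ᵈ (x ∷ p) []      = inj₂ (inj₁ (x ∷ p , refl))
  <ˡ⊎prefix⊎>ᵈ (x ∷ p) (y ∷ q) with compare x y
  ... | tri< x≺y _ _ = inj₁ (here x≺y)
  ... | tri> _ _ y≺x = inj₂ (inj₂ (here y≺x))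
  ... | tri≈ _ refl _ with <ˡ⊎prefix⊎>ᵈ p q
  ...   | inj₁ p<q            = inj₁ (there p<q)
  ...   | inj₂ (inj₁ (t , e)) = inj₂ (inj₁ (t , cong (x ∷_) e))
  ...   | inj₂ (inj₂ q<p)     = inj₂ (inj₂ (there q<p))

  <ˡ-properSuffix⇒<ᵈ : ∀ {u x m} → u ≡ x ++ m → NonEmpty x → u <ˡ m → u <ᵈ m
  <ˡ-properSuffix⇒<ᵈ {u} {x} {m} u≡xm x≢[] u<m with <ˡ⇒properPrefix⊎<ᵈ u<m
  ... | inj₂ u<ᵈm = u<ᵈm
  ... | inj₁ (t , _ , m≡ut) = ⊥-elim (<⇒≱ m<u u≤m)
    where
    m<u : length m < length u
    m<u = subst (λ z → length m < length z) (sym u≡xm) (length-++-<ʳ m x≢[])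
    u≤m : length u ≤ length m
    u≤m = subst (λ z → length u ≤ length z) (sym m≡ut) (length-++-≤ˡ u)

  -- Either u and y differ at some position, or y = u t and then v < t because v
  -- is Lyndon.
  ++-<ˡ-suffix : ∀ {u v} p y → NonEmpty u → IsLyndon v → v ≡ p ++ y →
                 u <ˡ y → (u ++ v) <ˡ y
  ++-<ˡ-suffix {u} {v} p y u≢[] (_ , v<suffix) v≡py u<y with <ˡ⇒properPrefix⊎<ᵈ u<y
  ... | inj₂ u<ᵈy = subst ((u ++ v) <ˡ_) (++-identityʳ y) (<ᵈ-++⇒<ˡ u<ᵈy v [])
  ... | inj₁ (t , t≢[] , y≡ut) =
    subst ((u ++ v) <ˡ_) (sym y≡ut) (++-monoʳ-<ˡ u (v<suffix (p ++ u) t (++-nonEmptyʳ p u≢[]) t≢[] v≡put))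
    where
    v≡put : v ≡ (p ++ u) ++ t
    v≡put = trans v≡py (trans (cong (p ++_) y≡ut) (sym (++-assoc p u t)))

  lyndon-++ : ∀ {u v} → IsLyndon u → IsLyndon v → u <ˡ v → IsLyndon (u ++ v)
  lyndon-++ {u} {v} (u≢[] , u<suffix) lv@(_ , v<suffix) u<v =
    ++-nonEmptyˡ v u≢[] , uv<suffix
    where
    uv<suffix : ∀ x y → NonEmpty x → NonEmpty y → u ++ v ≡ x ++ y → (u ++ v) <ˡ y
    uv<suffix x y x≢[] y≢[] eq with ++-equidivisible x y u v eq
    ... | inj₁ ([] , _ , v≡y) = ++-<ˡ-suffix [] y u≢[] lv v≡y (subst (u <ˡ_) v≡y u<v)
    ... | inj₁ (c ∷ m , _ , v≡my) =
      ++-<ˡ-suffix (c ∷ m) y u≢[] lv v≡my (<ˡ-trans u<v (v<suffix (c ∷ m) y (λ ()) y≢[] v≡my))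
    ... | inj₂ (m , m≢[] , u≡xm , y≡mv) =
      subst ((u ++ v) <ˡ_) (sym y≡mv)
        (<ᵈ-++⇒<ˡ (<ˡ-properSuffix⇒<ᵈ u≡xm x≢[] (u<suffix x m x≢[] m≢[] u≡xm)) v v)

  ¬<ˡ-rightFactor : ∀ {w u v v₁ v₂} → IsLeftStdFact w u v → IsLeftStdFact v v₁ v₂ →
                    ¬ (u <ˡ v₁)
  ¬<ˡ-rightFactor {w} {u} {v} {v₁} {v₂}
    (w≡uv , _ , _ , lu , u-longest) (v≡v₁v₂ , v₁≢[] , v₂≢[] , lv₁ , _) u<v₁ =
    <-irrefl refl (≤-<-trans uv₁≤u (length-++-<ˡ u v₁≢[]))
    where
    w≡uv₁v₂ : w ≡ (u ++ v₁) ++ v₂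
    w≡uv₁v₂ = trans w≡uv (trans (cong (u ++_) v≡v₁v₂) (sym (++-assoc u v₁ v₂)))
    uv₁≤u : length (u ++ v₁) ≤ length u
    uv₁≤u = u-longest (u ++ v₁) v₂ w≡uv₁v₂ v₂≢[] (lyndon-++ lu lv₁ u<v₁)

  leftFactor-prefix : ∀ {w u v v₁ v₂} → IsLyndon w → IsLeftStdFact w u v →
                      IsLeftStdFact v v₁ v₂ → IsPrefix v₁ u
  leftFactor-prefix {w} {u} {v} {v₁} {v₂} (_ , w<suffix) fw@(w≡uv , u≢[] , v≢[] , _) fv
    with <ˡ⊎prefix⊎>ᵈ u v₁
  ... | inj₁ u<v₁           = ⊥-elim (¬<ˡ-rightFactor fw fv u<v₁)
  ... | inj₂ (inj₁ v₁⊑u)    = v₁⊑u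
  ... | inj₂ (inj₂ v₁<ᵈu)   = ⊥-elim (<ˡ-asym (w<suffix u v u≢[] v≢[] w≡uv) v<w)
    where
    v<w : v <ˡ w
    v<w = subst₂ _<ˡ_ (sym (proj₁ fv)) (sym w≡uv) (<ᵈ-++⇒<ˡ v₁<ᵈu v₂ v)

corollary7 : {a ℓ : Level} (A : Set a) (_≺_ : A → A → Set ℓ)
    (isSTO : IsStrictTotalOrder _≡_ _≺_) →
    let open Words A _≺_ isSTO in
    (w u v v₁ v₂ : List A) →
    IsLyndon w → 2 ≤ length w →
    IsLeftStdFact w u v →
    ¬ (length v ≡ 1) →
    IsLeftStdFact v v₁ v₂ →
    IsPrefix v₁ u
corollary7 A _≺_ isSTO w u v v₁ v₂ lw _ fw _ fv = LyndonWords.leftFactor-prefix A _≺_ isSTO lw fw fv
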